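{- Let $N\ge 1$ and let $m$ be an integer with $0\le m<\frac{1}{2}N$. Then for every initial configuration of $m$ cars (each coloured red or blue, at distinct sites) on the torus $\mathbb{Z}_N\times\mathbb{Z}_N$, the BML dynamics attains speed one: there is a finite time $T$ such that for every $t\ge T$, every car moves during the time step from $t$ to $t+1$.
   Context: Write $\mathbb{Z}_N=\mathbb{Z}/N\mathbb{Z}$ and consider the torus $\mathbb{Z}_N\times\mathbb{Z}_N$; the first coordinate points vertically ("up" means increasing the first coordinate) and the second horizontally ("right" means increasing the second coordinate). A configuration consists of $m<N^2$ cars at distinct sites, each coloured red or blue. Time is discrete; each time step consists of two sub-steps. First all blue cars try to move simultaneously one step to the right: a blue car at $(i,j)$ fails to move if and only if for some $k\ge 0$ the sites $(i,j+1),\dots,(i,j+k)$ are occupied by blue cars and the site $(i,j+k+1)$ is occupied by a red car (i.e. a red car blocks it directly or blocks the horizontal line of blue cars in front of it); all other blue cars move one step right. Then, in the resulting configuration, all red cars try to move simultaneously one step up: a red car at $(i,j)$ fails to move if and only if for some $k\ge 0$ the sites $(i+1,j),\dots,(i+k,j)$ are occupied by red cars and $(i+k+1,j)$ is occupied by a blue car; all other red cars move one step up. A car that does not move in a time step is said to be blocked in that step. The system attains speed one if after some finite time no car is ever blocked. -}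

module Defs where

open import Data.Nat using (ℕ; zero; suc; _+_; _<_)
open import Data.Nat.DivMod using (_mod_)
open import Data.Fin using (Fin; toℕ)
open import Data.List using (List; map; allFin)
open import Data.Nat.ListAction using (sum)
open import Data.Product using (Σ; _×_; ∃)
open import Data.Sum using (_⊎_)
open import Data.Empty using (⊥)
open import Relation.Nullary using (¬_)
open import Relation.Binary.PropositionalEquality using (_≡_)
open import Function.Bundles using (_⇔_)

data Cell : Set where
  empty red blue : Cell

-- The torus Z_N × Z_N with N = suc n.  A configuration assigns to each
-- site (i , j) (i = vertical/first coordinate, j = horizontal/second) its content.
Config : ℕ → Set
Config n = Fin (suc n) → Fin (suc n) → Cell

_⊕_ : {n : ℕ} → Fin (suc n) → ℕ → Fin (suc n)
_⊕_ {n} j k = (toℕ j + k) mod (suc n)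

_⊖1 : {n : ℕ} → Fin (suc n) → Fin (suc n)
_⊖1 {n} j = j ⊕ n

isCar : Cell → ℕ
isCar empty = 0
isCar red   = 1
isCar blue  = 1

carCount : {n : ℕ} → Config n → ℕ
carCount {n} c = sum (map (λ i → sum (map (λ j → isCar (c i j)) (allFin (suc n)))) (allFin (suc n)))

BlueBlocked : {n : ℕ} → Config n → Fin (suc n) → Fin (suc n) → Set
BlueBlocked c i j =
  ∃ λ (k : ℕ) → ((l : ℕ) → l < k → c i (j ⊕ suc l) ≡ blue) × (c i (j ⊕ suc k) ≡ red)

RedBlocked : {n : ℕ} → Config n → Fin (suc n) → Fin (suc n) → Set
RedBlocked c i j =
  ∃ λ (k : ℕ) → ((l : ℕ) → l < k → c (i ⊕ suc l) j ≡ red) × (c (i ⊕ suc k) j ≡ blue)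

-- BlueStep c d : d is the configuration obtained from c by the blue sub-step
-- (all non-blocked blue cars move one step right, everything else stays).
BlueStep : {n : ℕ} → Config n → Config n → Set
BlueStep c d = ∀ i j →
  ((d i j ≡ red) ⇔ (c i j ≡ red)) ×
  ((d i j ≡ blue) ⇔
     ((c i (j ⊖1) ≡ blue × ¬ BlueBlocked c i (j ⊖1)) ⊎ (c i j ≡ blue × BlueBlocked c i j)))

-- RedStep d e : e is obtained from d by the red sub-step
-- (all non-blocked red cars move one step up, everything else stays).
RedStep : {n : ℕ} → Config n → Config n → Set
RedStep d e = ∀ i j →
  ((e i j ≡ blue) ⇔ (d i j ≡ blue)) ×
  ((e i j ≡ red) ⇔
     ((d (i ⊖1) j ≡ red × ¬ RedBlocked d (i ⊖1) j) ⊎ (d i j ≡ red × RedBlocked d i j)))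

-- A BML trajectory: c t is the configuration at time t, d t the configuration
-- after the blue sub-step of the time step from t to t+1.
record Trajectory (n : ℕ) : Set where
  field
    conf  : ℕ → Config n
    mid   : ℕ → Config n
    blueS : ∀ t → BlueStep (conf t) (mid t)
    redS  : ∀ t → RedStep (mid t) (conf (suc t))

open Trajectory public

NoCarBlockedAt : {n : ℕ} → Trajectory n → ℕ → Set
NoCarBlockedAt τ t = ∀ i j →
  (conf τ t i j ≡ blue → ¬ BlueBlocked (conf τ t) i j) ×
  (mid τ t i j ≡ red → ¬ RedBlocked (mid τ t) i j)

SpeedOne : {n : ℕ} → Trajectory n → Set
SpeedOne τ = ∃ λ (T : ℕ) → ∀ t → T Data.Nat.≤ t → NoCarBlockedAt τ t

{-# OPTIONS --safe #-}
-- Label site (i , j) at time t by a + i + j − t (mod N), for a shift a ∈ ℤ_N: a car keeps its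
-- label when it moves and loses one when it is blocked.  Call a shift good at time t if no car
-- carries one of the two top labels N − 1, N − 2.  Each car spoils two shifts, so as 2m < N some
-- shift is good at every time.  A shift good at t + 1 was good at t (a car with a top label at t
-- still has one at t + 1, or is blocked by a car that does), so from t to t + 1 no label wraps
-- around: the sum Φ of the labels of all cars does not increase, and drops when a car is blocked.
-- Summing Φ over the good shifts gives a non-increasing M : ℕ → ℕ that drops at every blocking.
-- Hence some N consecutive steps see no blocking; during them every car travels once around the
-- torus, so the configuration returns to itself, and by determinism the motion is N-periodic and
-- free from then on.
module Submission where

open import Defs
open import Data.Bool using (if_then_else_)
open import Data.Nat
  using (ℕ; zero; suc; _+_; _*_; _∸_; _≤_; _<_; _≤′_; ≤′-refl; ≤′-step; _≟_; z≤n; s≤s; z<s)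
open import Data.Nat.Properties
open import Data.Nat.DivMod
  using (_%_; m%n<n; m<n⇒m%n≡m; %-distribˡ-+; m%n%n≡m%n; [m+kn]%n≡m%n)
open import Data.Fin using (Fin; toℕ; fromℕ; inject₁) renaming (zero to fzero; suc to fsuc)
open import Data.Fin.Properties
  using (toℕ-injective; toℕ-fromℕ<; toℕ<n; toℕ-fromℕ; toℕ-inject₁-≢; all?)
open import Data.Fin.Permutation using (Permutation′; permutation)
open import Data.List using (map; allFin; tabulate)
open import Data.List.Properties using (map-tabulate)
import Data.Nat.ListAction as List
open import Data.Product using (∃; _×_; _,_; proj₁; proj₂; swap; uncurry)
open import Data.Sum using (_⊎_; inj₁; inj₂)
open import Function using (_∘_; id; flip)
open import Function.Bundles using (_⇔_; mk⇔; Equivalence)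
import Function.Properties.Equivalence as ⇔
open import Relation.Nullary using (¬_; Dec; yes; no; does; ¬?; contradiction)
open import Relation.Nullary.Decidable using (_×-dec_; _⊎-dec_; _→-dec_; map′)
open import Relation.Binary.PropositionalEquality
open import Algebra.Properties.CommutativeMonoid.Sum +-0-commutativeMonoid
  using ( sum; sum-syntax; sum-cong-≗; sum-replicate-zero; sum-init-last; sum-remove
        ; ∑-distrib-+; ∑-comm; ∑-permute)

open Equivalence using (to; from)

mask : ∀ {P : Set} → Dec P → ℕ → ℕ
mask P? x = if does P? then x else 0

private variable
  P Q R : Set
  x y : ℕ

mask-yes : (P? : Dec P) → P → mask P? x ≡ x
mask-yes (yes _) _ = refl
mask-yes (no ¬p) p = contradiction p ¬p

mask-no : (P? : Dec P) → ¬ P → mask P? x ≡ 0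
mask-no (yes p) ¬p = contradiction p ¬p
mask-no (no _)  _  = refl

mask-⇔ : (P? : Dec P) (Q? : Dec Q) → P ⇔ Q → mask P? x ≡ mask Q? x
mask-⇔ (yes _) (yes _)  _   = refl
mask-⇔ (no _)  (no _)   _   = refl
mask-⇔ (yes p) (no ¬q)  P⇔Q = contradiction (to P⇔Q p) ¬q
mask-⇔ (no ¬p) (yes q)  P⇔Q = contradiction (from P⇔Q q) ¬p

mask-mono : (P? : Dec P) (Q? : Dec Q) → (P → Q) → (P → x ≤ y) → mask P? x ≤ mask Q? y
mask-mono (yes p) (yes _) _   x≤y = x≤y p
mask-mono (yes p) (no ¬q) P⇒Q _   = contradiction (P⇒Q p) ¬q
mask-mono (no _)  _       _   _   = z≤n

mask-mono-< : (P? : Dec P) (Q? : Dec Q) → P → (P → Q) → x < y → mask P? x < mask Q? y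
mask-mono-< (yes _) (yes _) _ _   x<y = x<y
mask-mono-< (yes p) (no ¬q) _ P⇒Q _   = contradiction (P⇒Q p) ¬q
mask-mono-< (no ¬p) _       p _   _   = contradiction p ¬p

mask-split : (P? : Dec P) (Q? : Dec Q) → mask P? x ≡ mask (P? ×-dec ¬? Q?) x + mask (P? ×-dec Q?) x
mask-split (yes _) (yes _) = refl
mask-split (yes _) (no _)  = sym (+-identityʳ _)
mask-split (no _)  _       = refl

mask-⊎ : (P? : Dec P) (Q? : Dec Q) (R? : Dec R) → P ⇔ (Q ⊎ R) → ¬ (Q × R) →
         mask P? x ≡ mask Q? x + mask R? x
mask-⊎ (yes _) (yes q) (yes r) _ excl = contradiction (q , r) excl
mask-⊎ (yes _) (yes _) (no _)  _ _    = sym (+-identityʳ _)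
mask-⊎ (yes _) (no _)  (yes _) _ _    = refl
mask-⊎ (yes p) (no ¬q) (no ¬r) P⇔Q⊎R _ with to P⇔Q⊎R p
... | inj₁ q = contradiction q ¬q
... | inj₂ r = contradiction r ¬r
mask-⊎ (no ¬p) (yes q) _       P⇔Q⊎R _ = contradiction (from P⇔Q⊎R (inj₁ q)) ¬p
mask-⊎ (no ¬p) (no _)  (yes r) P⇔Q⊎R _ = contradiction (from P⇔Q⊎R (inj₂ r)) ¬p
mask-⊎ (no _)  (no _)  (no _)  _     _ = refl

mask-⊎-≤ : (P? : Dec P) (Q? : Dec Q) → mask (P? ⊎-dec Q?) x ≤ mask P? x + mask Q? x
mask-⊎-≤ (yes _) (yes _) = m≤m+n _ _
mask-⊎-≤ (yes _) (no _)  = m≤m+n _ 0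
mask-⊎-≤ (no _)  (yes _) = ≤-refl
mask-⊎-≤ (no _)  (no _)  = z≤n

sum-mono-≤ : ∀ {k} {f g : Fin k → ℕ} → (∀ i → f i ≤ g i) → sum f ≤ sum g
sum-mono-≤ {zero}  _   = z≤n
sum-mono-≤ {suc _} f≤g = +-mono-≤ (f≤g fzero) (sum-mono-≤ (f≤g ∘ fsuc))

sum-mono-< : ∀ {k} {f g : Fin k → ℕ} → (∀ i → f i ≤ g i) → ∀ i → f i < g i → sum f < sum g
sum-mono-< f≤g fzero    fi<gi = +-mono-<-≤ fi<gi (sum-mono-≤ (f≤g ∘ fsuc))
sum-mono-< f≤g (fsuc i) fi<gi = +-mono-≤-< (f≤g fzero) (sum-mono-< (f≤g ∘ fsuc) i fi<gi)

≤-sum : ∀ {k} (f : Fin (suc k) → ℕ) i → f i ≤ sum f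
≤-sum f i = subst (f i ≤_) (sym (sum-remove {i = i} f)) (m≤m+n _ _)

sum<k⇒∃≡0 : ∀ {k} (f : Fin k → ℕ) → sum f < k → ∃ λ i → f i ≡ 0
sum<k⇒∃≡0 {suc _} f sum<k with f fzero ≟ 0
... | yes f₀≡0 = fzero , f₀≡0
... | no  f₀≢0 =
  let i , fi≡0 = sum<k⇒∃≡0 (f ∘ fsuc) (≤-trans (+-monoˡ-≤ _ (n≢0⇒n>0 f₀≢0)) (≤-pred sum<k))
  in fsuc i , fi≡0

sum-tabulate : ∀ {k} (f : Fin k → ℕ) → List.sum (tabulate f) ≡ sum f
sum-tabulate {zero}  f = refl
sum-tabulate {suc _} f = cong (f fzero +_) (sum-tabulate (f ∘ fsuc))

sum-allFin : ∀ {k} (f : Fin k → ℕ) → List.sum (map f (allFin k)) ≡ sum f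
sum-allFin f = trans (cong List.sum (map-tabulate id f)) (sum-tabulate f)

module _ {f : ℕ → ℕ} (f-antitone : ∀ t → f (suc t) ≤ f t) where

  antitone-≤ : ∀ {s t} → s ≤ t → f t ≤ f s
  antitone-≤ = go ∘ ≤⇒≤′
    where
    go : ∀ {s t} → s ≤′ t → f t ≤ f s
    go ≤′-refl        = ≤-refl
    go (≤′-step s≤′t) = ≤-trans (f-antitone _) (go s≤′t)

  plateau : ∀ p → ∃ λ T → f (p + T) ≡ f T
  plateau p = descend (f 0) 0 ≤-refl
    where
    descend : ∀ b T → f T ≤ b → ∃ λ T → f (p + T) ≡ f T
    descend zero T fT≤0 =
      T , trans (n≤0⇒n≡0 (≤-trans (antitone-≤ (m≤n+m T p)) fT≤0)) (sym (n≤0⇒n≡0 fT≤0))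
    descend (suc b) T fT≤1+b with f (p + T) ≟ f T
    ... | yes same = T , same
    ... | no  drop = descend b (p + T) (≤-pred (≤-trans (≤∧≢⇒< (antitone-≤ (m≤n+m T p)) drop) fT≤1+b))

  plateau-steps : ∀ {p T} → f (p + T) ≡ f T → ∀ r → r < p → f (suc (r + T)) ≡ f (r + T)
  plateau-steps {p} {T} same r r<p = ≤-antisym (f-antitone (r + T)) (begin
    f (r + T)     ≤⟨ antitone-≤ (m≤n+m T r) ⟩
    f T           ≡⟨ same ⟨
    f (p + T)     ≤⟨ antitone-≤ (+-monoˡ-≤ T r<p) ⟩
    f (suc (r + T)) ∎)
    where open ≤-Reasoning

_≟ᶜ_ : (x y : Cell) → Dec (x ≡ y)
empty ≟ᶜ empty = yes refl
red   ≟ᶜ red   = yes refl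
blue  ≟ᶜ blue  = yes refl
empty ≟ᶜ red   = no λ ()
empty ≟ᶜ blue  = no λ ()
red   ≟ᶜ empty = no λ ()
red   ≟ᶜ blue  = no λ ()
blue  ≟ᶜ empty = no λ ()
blue  ≟ᶜ red   = no λ ()

cell-≡ : ∀ {x y} → (x ≡ blue ⇔ y ≡ blue) → (x ≡ red ⇔ y ≡ red) → x ≡ y
cell-≡ {empty} {empty} _ _ = refl
cell-≡ {empty} {red}   _ r = from r refl
cell-≡ {empty} {blue}  b _ = from b refl
cell-≡ {red}           _ r = sym (to r refl)
cell-≡ {blue}          b _ = sym (to b refl)

isCar-mask : ∀ x → isCar x ≡ mask (x ≟ᶜ blue) 1 + mask (x ≟ᶜ red) 1
isCar-mask empty = refl
isCar-mask red   = refl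
isCar-mask blue  = refl

module Torus (n : ℕ) where

  N : ℕ
  N = suc n

  toℕ-⊕ : ∀ (j : Fin N) k → toℕ (j ⊕ k) ≡ (toℕ j + k) % N
  toℕ-⊕ j k = toℕ-fromℕ< (m%n<n (toℕ j + k) N)

  [m+k%N]%N : ∀ m k → (m + k % N) % N ≡ (m + k) % N
  [m+k%N]%N m k = begin
    (m + k % N) % N           ≡⟨ %-distribˡ-+ m (k % N) N ⟩
    (m % N + k % N % N) % N   ≡⟨ cong (λ r → (m % N + r) % N) (m%n%n≡m%n k N) ⟩
    (m % N + k % N) % N       ≡⟨ %-distribˡ-+ m k N ⟨
    (m + k) % N               ∎
    where open ≡-Reasoning

  ⊕-cong : ∀ {i j : Fin N} {a b} → (toℕ i + a) % N ≡ (toℕ j + b) % N → i ⊕ a ≡ j ⊕ b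
  ⊕-cong {i} {j} {a} {b} eq = toℕ-injective (trans (toℕ-⊕ i a) (trans eq (sym (toℕ-⊕ j b))))

  ⊕-identityʳ : ∀ (j : Fin N) → j ⊕ 0 ≡ j
  ⊕-identityʳ j = toℕ-injective (trans (toℕ-⊕ j 0)
    (trans (cong (_% N) (+-identityʳ (toℕ j))) (m<n⇒m%n≡m (toℕ<n j))))

  ⊕-% : ∀ (j : Fin N) k → j ⊕ (k % N) ≡ j ⊕ k
  ⊕-% j k = ⊕-cong {j} {j} ([m+k%N]%N (toℕ j) k)

  ⊕-assoc : ∀ (j : Fin N) a b → (j ⊕ a) ⊕ b ≡ j ⊕ (a + b)
  ⊕-assoc j a b = ⊕-cong {j ⊕ a} {j} (begin
    (toℕ (j ⊕ a) + b) % N       ≡⟨ cong (λ r → (r + b) % N) (toℕ-⊕ j a) ⟩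
    ((toℕ j + a) % N + b) % N   ≡⟨ cong (_% N) (+-comm _ b) ⟩
    (b + (toℕ j + a) % N) % N   ≡⟨ [m+k%N]%N b _ ⟩
    (b + (toℕ j + a)) % N       ≡⟨ cong (_% N) (trans (+-comm b _) (+-assoc (toℕ j) a b)) ⟩
    (toℕ j + (a + b)) % N       ∎)
    where open ≡-Reasoning

  ⊕-swap : ∀ (j : Fin N) a b → (j ⊕ a) ⊕ b ≡ (j ⊕ b) ⊕ a
  ⊕-swap j a b = trans (⊕-assoc j a b) (trans (cong (j ⊕_) (+-comm a b)) (sym (⊕-assoc j b a)))

  ⊕-toℕ : ∀ (i j : Fin N) k → i ⊕ toℕ (j ⊕ k) ≡ (i ⊕ toℕ j) ⊕ k
  ⊕-toℕ i j k = begin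
    i ⊕ toℕ (j ⊕ k)      ≡⟨ cong (i ⊕_) (toℕ-⊕ j k) ⟩
    i ⊕ ((toℕ j + k) % N) ≡⟨ ⊕-% i _ ⟩
    i ⊕ (toℕ j + k)      ≡⟨ ⊕-assoc i (toℕ j) k ⟨
    (i ⊕ toℕ j) ⊕ k      ∎
    where open ≡-Reasoning

  ⊕-N* : ∀ (j : Fin N) k → j ⊕ (N * k) ≡ j
  ⊕-N* j k = toℕ-injective (begin
    toℕ (j ⊕ (N * k))     ≡⟨ toℕ-⊕ j (N * k) ⟩
    (toℕ j + N * k) % N   ≡⟨ cong (λ r → (toℕ j + r) % N) (*-comm N k) ⟩
    (toℕ j + k * N) % N   ≡⟨ [m+kn]%n≡m%n (toℕ j) k N ⟩
    toℕ j % N             ≡⟨ m<n⇒m%n≡m (toℕ<n j) ⟩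
    toℕ j                 ∎)
    where open ≡-Reasoning

  ⊕-N : ∀ (j : Fin N) → j ⊕ N ≡ j
  ⊕-N j = trans (cong (j ⊕_) (sym (*-identityʳ N))) (⊕-N* j 1)

  ⊕-period : ∀ (j : Fin N) k → j ⊕ (N + k) ≡ j ⊕ k
  ⊕-period j k = trans (cong (j ⊕_) (+-comm N k)) (trans (sym (⊕-assoc j k N)) (⊕-N (j ⊕ k)))

  ⊖1-⊕suc : ∀ (j : Fin N) k → (j ⊖1) ⊕ suc k ≡ j ⊕ k
  ⊖1-⊕suc j k = trans (⊕-assoc j n (suc k)) (trans (cong (j ⊕_) (+-suc n k)) (⊕-period j k))

  ⊖1⊕1 : ∀ (j : Fin N) → (j ⊖1) ⊕ 1 ≡ j
  ⊖1⊕1 j = trans (⊖1-⊕suc j 0) (⊕-identityʳ j)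

  ⊕1⊖1 : ∀ (j : Fin N) → (j ⊕ 1) ⊖1 ≡ j
  ⊕1⊖1 j = trans (⊕-assoc j 1 n) (⊕-N j)

  toℕ-⊕1 : ∀ (x : Fin N) → toℕ x < n → toℕ (x ⊕ 1) ≡ suc (toℕ x)
  toℕ-⊕1 x x<n = trans (toℕ-⊕ x 1) (trans (cong (_% N) (+-comm (toℕ x) 1)) (m<n⇒m%n≡m (s≤s x<n)))

  rotation : ℕ → Permutation′ N
  rotation k = permutation (_⊕ k) (_⊕ (n * k))
    (λ j → trans (⊕-assoc j (n * k) k) (trans (cong (j ⊕_) (+-comm (n * k) k)) (⊕-N* j k)))
    (λ j → trans (⊕-assoc j k (n * k)) (⊕-N* j k))

  sum-⊕ : ∀ (f : Fin N → ℕ) k → ∑[ j < N ] f (j ⊕ k) ≡ sum f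
  sum-⊕ f k = sym (∑-permute f (rotation k))

  Top : Fin N → Set
  Top x = toℕ x ≡ n

  High : Fin N → Set
  High x = Top x ⊎ Top (x ⊕ 1)

  top? : ∀ x → Dec (Top x)
  top? x = toℕ x ≟ n

  high? : ∀ x → Dec (High x)
  high? x = top? x ⊎-dec top? (x ⊕ 1)

  ¬Top⇒<n : ∀ {x} → ¬ Top x → toℕ x < n
  ¬Top⇒<n {x} ¬top = ≤∧≢⇒< (≤-pred (toℕ<n x)) ¬top

  sum-top : ∀ x → ∑[ a < N ] mask (top? a) x ≡ x
  sum-top x = begin
    ∑[ a < N ] mask (top? a) x
      ≡⟨ sum-init-last (λ a → mask (top? a) x) ⟩
    ∑[ a < n ] mask (top? (inject₁ a)) x + mask (top? (fromℕ n)) x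
      ≡⟨ cong₂ _+_ below-top at-top ⟩
    0 + x ∎
    where
    open ≡-Reasoning
    below-top : ∑[ a < n ] mask (top? (inject₁ a)) x ≡ 0
    below-top = trans (sum-cong-≗ λ a → mask-no (top? (inject₁ a)) (toℕ-inject₁-≢ a ∘ sym))
                      (sum-replicate-zero n)
    at-top : mask (top? (fromℕ n)) x ≡ x
    at-top = mask-yes (top? (fromℕ n)) (toℕ-fromℕ n)

  sum-high-⊕ : ∀ k x → ∑[ a < N ] mask (high? (a ⊕ k)) x ≤ x + x
  sum-high-⊕ k x = begin
    ∑[ a < N ] mask (high? (a ⊕ k)) x
      ≤⟨ sum-mono-≤ (λ a → mask-⊎-≤ {x = x} (top? (a ⊕ k)) (top? ((a ⊕ k) ⊕ 1))) ⟩
    ∑[ a < N ] (mask (top? (a ⊕ k)) x + mask (top? ((a ⊕ k) ⊕ 1)) x)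
      ≡⟨ ∑-distrib-+ (λ a → mask (top? (a ⊕ k)) x) (λ a → mask (top? ((a ⊕ k) ⊕ 1)) x) ⟩
    ∑[ a < N ] mask (top? (a ⊕ k)) x + ∑[ a < N ] mask (top? ((a ⊕ k) ⊕ 1)) x
      ≡⟨ cong₂ _+_ (sum-top-⊕ k)
                   (trans (sum-cong-≗ λ a → cong (λ y → mask (top? y) x) (⊕-assoc a k 1)) (sum-top-⊕ (k + 1))) ⟩
    x + x ∎
    where
    open ≤-Reasoning
    sum-top-⊕ : ∀ k → ∑[ a < N ] mask (top? (a ⊕ k)) x ≡ x
    sum-top-⊕ k = trans (sum-⊕ (λ a → mask (top? a) x) k) (sum-top x)

  W : Cell → (Fin N → Cell) → (Fin N → ℕ) → ℕ
  W μ c w = ∑[ j < N ] mask (c j ≟ᶜ μ) (w j)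

  -- One line of the torus on which μ-cars advance and ν-cars block them: the rows of a blue
  -- sub-step and the columns of a red sub-step are instances, definitionally.
  module Line (μ ν : Cell) (μ≢ν : μ ≢ ν) where

    Blocked : (Fin N → Cell) → Fin N → Set
    Blocked c j = ∃ λ k → ((l : ℕ) → l < k → c (j ⊕ suc l) ≡ μ) × (c (j ⊕ suc k) ≡ ν)

    Step : (c d : Fin N → Cell) → Set
    Step c d = ∀ j → ((d j ≡ ν) ⇔ (c j ≡ ν)) ×
      ((d j ≡ μ) ⇔ ((c (j ⊖1) ≡ μ × ¬ Blocked c (j ⊖1)) ⊎ (c j ≡ μ × Blocked c j)))

    -- Were k ≥ N, the blocking site j ⊕ suc k would also be the μ-site j ⊕ suc (k ∸ N).
    blocking-distance<N : ∀ {c j} (b : Blocked c j) → proj₁ b < N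
    blocking-distance<N {c} {j} (k , chain , end) with k <? N
    ... | yes k<N = k<N
    ... | no  k≮N = contradiction (trans (sym (chain (k ∸ N) l<k)) (trans (cong c same-site) end)) μ≢ν
      where
      N≤k : N ≤ k
      N≤k = ≮⇒≥ k≮N
      l<k : k ∸ N < k
      l<k = ∸-monoʳ-< z<s N≤k
      same-site : j ⊕ suc (k ∸ N) ≡ j ⊕ suc k
      same-site = trans (sym (⊕-period j _)) (cong (j ⊕_) (trans (+-suc N _) (cong suc (m+[n∸m]≡n N≤k))))

    blocked? : ∀ c j → Dec (Blocked c j)
    blocked? c j = map′ forget-bound add-bound (anyUpTo? (λ k → allUpTo? μ-at k ×-dec ν-at k) N)
      where
      μ-at : ∀ l → Dec (c (j ⊕ suc l) ≡ μ)
      μ-at l = c (j ⊕ suc l) ≟ᶜ μ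
      ν-at : ∀ k → Dec (c (j ⊕ suc k) ≡ ν)
      ν-at k = c (j ⊕ suc k) ≟ᶜ ν
      Bounded : Set
      Bounded = ∃ λ k → k < N × ((∀ {l} → l < k → c (j ⊕ suc l) ≡ μ) × (c (j ⊕ suc k) ≡ ν))
      forget-bound : Bounded → Blocked c j
      forget-bound (k , _ , chain , end) = k , (λ l → chain {l}) , end
      add-bound : Blocked c j → Bounded
      add-bound b@(k , chain , end) = k , blocking-distance<N {c} {j} b , (λ {l} → chain l) , end

    Blocked-⊖1 : ∀ {c j} → c j ≡ μ → Blocked c j → Blocked c (j ⊖1)
    Blocked-⊖1 {c} {j} cj≡μ (k , chain , end) =
      suc k , chain′ , subst (λ p → c p ≡ ν) (sym (⊖1-⊕suc j (suc k))) end
      where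
      chain′ : (l : ℕ) → l < suc k → c ((j ⊖1) ⊕ suc l) ≡ μ
      chain′ zero    _         = subst (λ p → c p ≡ μ) (sym (⊖1⊕1 j)) cj≡μ
      chain′ (suc l) (s≤s l<k) = subst (λ p → c p ≡ μ) (sym (⊖1-⊕suc j (suc l))) (chain l l<k)

    Blocked-resp : ∀ {c c′ j} → c ≗ c′ → Blocked c j → Blocked c′ j
    Blocked-resp {j = j} c≗c′ (k , chain , end) =
      k , (λ l l<k → trans (sym (c≗c′ (j ⊕ suc l))) (chain l l<k)) , trans (sym (c≗c′ (j ⊕ suc k))) end

    Step-unique : ∀ {c c′ d d′} → Step c d → Step c′ d′ → c ≗ c′ →
                  ∀ j → (d j ≡ μ ⇔ d′ j ≡ μ) × (d j ≡ ν ⇔ d′ j ≡ ν)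
    Step-unique {c} {c′} st st′ c≗c′ j =
      mk⇔ (μ-transfer st st′ c≗c′) (μ-transfer st′ st c′≗c) ,
      mk⇔ (ν-transfer st st′ c≗c′) (ν-transfer st′ st c′≗c)
      where
      c′≗c : c′ ≗ c
      c′≗c p = sym (c≗c′ p)
      μ-transfer : ∀ {c c′ d d′} → Step c d → Step c′ d′ → c ≗ c′ → d j ≡ μ → d′ j ≡ μ
      μ-transfer st st′ c≗c′ dj≡μ with to (proj₂ (st j)) dj≡μ
      ... | inj₁ (c≡μ , free)  = from (proj₂ (st′ j)) (inj₁ (trans (sym (c≗c′ (j ⊖1))) c≡μ ,
              λ stuck → free (Blocked-resp {j = j ⊖1} (λ p → sym (c≗c′ p)) stuck)))
      ... | inj₂ (c≡μ , stuck) = from (proj₂ (st′ j)) (inj₂ (trans (sym (c≗c′ j)) c≡μ ,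
              Blocked-resp {j = j} c≗c′ stuck))
      ν-transfer : ∀ {c c′ d d′} → Step c d → Step c′ d′ → c ≗ c′ → d j ≡ ν → d′ j ≡ ν
      ν-transfer st st′ c≗c′ = from (proj₁ (st′ j)) ∘ trans (sym (c≗c′ j)) ∘ to (proj₁ (st j))

    module _ {c d} (step : Step c d) where

      ν-kept : ∀ {j} → c j ≡ ν → d j ≡ ν
      ν-kept {j} = from (proj₁ (step j))

      stays : ∀ {j} → c j ≡ μ → Blocked c j → d j ≡ μ
      stays {j} cj≡μ stuck = from (proj₂ (step j)) (inj₂ (cj≡μ , stuck))

      moves : ∀ {j} → c j ≡ μ → ¬ Blocked c j → d (j ⊕ 1) ≡ μ
      moves {j} cj≡μ free = from (proj₂ (step (j ⊕ 1))) (inj₁ (subst Free (sym (⊕1⊖1 j)) (cj≡μ , free)))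
        where
        Free : Fin N → Set
        Free p = c p ≡ μ × ¬ Blocked c p

      free-flow : (∀ j → c j ≡ μ → ¬ Blocked c j) → ∀ j → c j ≡ μ ⇔ d (j ⊕ 1) ≡ μ
      free-flow free j = mk⇔ (λ cj≡μ → moves cj≡μ (free j cj≡μ)) arrived
        where
        arrived : d (j ⊕ 1) ≡ μ → c j ≡ μ
        arrived dj⁺≡μ with to (proj₂ (step (j ⊕ 1))) dj⁺≡μ
        ... | inj₁ (c≡μ , _)     = subst (λ p → c p ≡ μ) (⊕1⊖1 j) c≡μ
        ... | inj₂ (c≡μ , stuck) = contradiction stuck (free (j ⊕ 1) c≡μ)

      moving? : ∀ j → Dec (c j ≡ μ × ¬ Blocked c j)
      moving? j = (c j ≟ᶜ μ) ×-dec ¬? (blocked? c j)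

      stuck? : ∀ j → Dec (c j ≡ μ × Blocked c j)
      stuck? j = (c j ≟ᶜ μ) ×-dec blocked? c j

      W-before : ∀ (w : Fin N → ℕ) →
                 W μ c w ≡ ∑[ j < N ] mask (moving? j) (w j) + ∑[ j < N ] mask (stuck? j) (w j)
      W-before w = trans (sum-cong-≗ λ j → mask-split {x = w j} (c j ≟ᶜ μ) (blocked? c j))
                         (∑-distrib-+ (λ j → mask (moving? j) (w j)) (λ j → mask (stuck? j) (w j)))

      W-after : ∀ {w w′ : Fin N → ℕ} → (∀ j → w′ (j ⊕ 1) ≡ w j) →
                W μ d w′ ≡ ∑[ j < N ] mask (moving? j) (w j) + ∑[ j < N ] mask (stuck? j) (w′ j)
      W-after {w} {w′} carried = begin
        ∑[ j < N ] mask (d j ≟ᶜ μ) (w′ j)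
          ≡⟨ sum-cong-≗ (λ j → mask-⊎ {x = w′ j} (d j ≟ᶜ μ) (moving? (j ⊖1)) (stuck? j)
                                      (proj₂ (step j)) (exclusive j)) ⟩
        ∑[ j < N ] (mask (moving? (j ⊖1)) (w′ j) + mask (stuck? j) (w′ j))
          ≡⟨ ∑-distrib-+ (λ j → mask (moving? (j ⊖1)) (w′ j)) (λ j → mask (stuck? j) (w′ j)) ⟩
        ∑[ j < N ] mask (moving? (j ⊖1)) (w′ j) + ∑[ j < N ] mask (stuck? j) (w′ j)
          ≡⟨ cong (_+ stuck-part) (sum-⊕ (λ j → mask (moving? (j ⊖1)) (w′ j)) 1) ⟨
        ∑[ j < N ] mask (moving? ((j ⊕ 1) ⊖1)) (w′ (j ⊕ 1)) + ∑[ j < N ] mask (stuck? j) (w′ j)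
          ≡⟨ cong (_+ stuck-part) (sum-cong-≗ λ j →
               cong₂ (λ p x → mask (moving? p) x) (⊕1⊖1 j) (carried j)) ⟩
        ∑[ j < N ] mask (moving? j) (w j) + ∑[ j < N ] mask (stuck? j) (w′ j) ∎
        where
        open ≡-Reasoning
        stuck-part : ℕ
        stuck-part = ∑[ j < N ] mask (stuck? j) (w′ j)
        exclusive : ∀ j → ¬ ((c (j ⊖1) ≡ μ × ¬ Blocked c (j ⊖1)) × (c j ≡ μ × Blocked c j))
        exclusive j ((_ , free) , cj≡μ , stuck) = free (Blocked-⊖1 {c} {j} cj≡μ stuck)

      module _ {w w′ : Fin N → ℕ} (carried : ∀ j → w′ (j ⊕ 1) ≡ w j)
               (stuck-≤ : ∀ j → c j ≡ μ → Blocked c j → w′ j ≤ w j) where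

        private
          moving-part : ℕ
          moving-part = ∑[ j < N ] mask (moving? j) (w j)
          stuck-mono : ∀ j → mask (stuck? j) (w′ j) ≤ mask (stuck? j) (w j)
          stuck-mono j = mask-mono (stuck? j) (stuck? j) id (uncurry (stuck-≤ j))

        W-step-≤ : W μ d w′ ≤ W μ c w
        W-step-≤ = begin
          W μ d w′
            ≡⟨ W-after {w} {w′} carried ⟩
          moving-part + ∑[ j < N ] mask (stuck? j) (w′ j)
            ≤⟨ +-monoʳ-≤ moving-part (sum-mono-≤ stuck-mono) ⟩
          moving-part + ∑[ j < N ] mask (stuck? j) (w j)
            ≡⟨ W-before w ⟨
          W μ c w ∎
          where open ≤-Reasoning

        W-step-< : ∀ {j} → c j ≡ μ → Blocked c j → w′ j < w j → W μ d w′ < W μ c w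
        W-step-< {j} cj≡μ stuck w′<w = begin-strict
          W μ d w′
            ≡⟨ W-after {w} {w′} carried ⟩
          moving-part + ∑[ j < N ] mask (stuck? j) (w′ j)
            <⟨ +-monoʳ-< moving-part (sum-mono-< stuck-mono j stuck-drops) ⟩
          moving-part + ∑[ j < N ] mask (stuck? j) (w j)
            ≡⟨ W-before w ⟨
          W μ c w ∎
          where
          open ≤-Reasoning
          stuck-drops : mask (stuck? j) (w′ j) < mask (stuck? j) (w j)
          stuck-drops = mask-mono-< (stuck? j) (stuck? j) (cj≡μ , stuck) id w′<w

    Good : (Fin N → Cell) → (f g : Fin N → Fin N) → Set
    Good c f g = ∀ j → (c j ≡ μ → ¬ High (f j)) × (c j ≡ ν → ¬ High (g j))

    -- f and f′ label the μ-cars before and after the step, g the ν-cars, which stay put.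
    record Labelling (f f′ g : Fin N → Fin N) : Set where
      field
        ascending : ∀ j → f (j ⊕ 1) ≡ f j ⊕ 1
        carried   : ∀ j → f′ (j ⊕ 1) ≡ f j
        ticked    : ∀ j → f′ j ⊕ 1 ≡ f j
        blocker   : ∀ j → Top (f j ⊕ 1) → High (g (j ⊕ 1))

    module _ {c d f f′ g} (step : Step c d) (labelling : Labelling f f′ g) (good : Good d f′ g) where
      open Labelling labelling

      top-car-impossible : ∀ {j} → c j ≡ μ → ¬ Top (f j)
      top-car-impossible {j} cj≡μ top with blocked? c j
      ... | no  free  = proj₁ (good (j ⊕ 1)) (moves step cj≡μ free) (subst High (sym (carried j)) (inj₁ top))
      ... | yes stuck = proj₁ (good j) (stays step cj≡μ stuck) (inj₂ (subst Top (sym (ticked j)) top))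

      high-car-impossible : ∀ {j} → c j ≡ μ → ¬ High (f j)
      high-car-impossible cj≡μ (inj₁ top) = top-car-impossible cj≡μ top
      high-car-impossible {j} cj≡μ (inj₂ top⁺) with blocked? c j
      ... | no  free                  =
        proj₁ (good (j ⊕ 1)) (moves step cj≡μ free) (subst High (sym (carried j)) (inj₂ top⁺))
      ... | yes (zero  , _     , end) = proj₂ (good (j ⊕ 1)) (ν-kept step end) (blocker j top⁺)
      ... | yes (suc _ , chain , _)   = top-car-impossible (chain 0 z<s) (subst Top (sym (ascending j)) top⁺)

      Good-backward : Good c f g
      Good-backward j = high-car-impossible , λ cj≡ν → proj₂ (good j) (ν-kept step cj≡ν)

      stuck-label-drops : ∀ {j} → c j ≡ μ → Blocked c j → toℕ (f′ j) < toℕ (f j)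
      stuck-label-drops {j} cj≡μ stuck =
        ≤-reflexive (trans (sym (toℕ-⊕1 (f′ j) below-top)) (cong toℕ (ticked j)))
        where
        below-top : toℕ (f′ j) < n
        below-top = ¬Top⇒<n λ top → proj₁ (good j) (stays step cj≡μ stuck) (inj₁ top)

  module Row    = Line blue red (λ ())
  module Column = Line red blue (λ ())

  _≋_ : Config n → Config n → Set
  c ≋ c′ = ∀ i j → c i j ≡ c′ i j

  BlueStep-unique : ∀ {c c′ d d′} → BlueStep c d → BlueStep c′ d′ → c ≋ c′ → d ≋ d′
  BlueStep-unique st st′ c≋c′ i j = uncurry cell-≡ (Row.Step-unique (st i) (st′ i) (c≋c′ i) j)

  RedStep-unique : ∀ {c c′ d d′} → RedStep c d → RedStep c′ d′ → c ≋ c′ → d ≋ d′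
  RedStep-unique st st′ c≋c′ i j =
    uncurry (flip cell-≡) (Column.Step-unique (λ i → st i j) (λ i → st′ i j) (λ i → c≋c′ i j) i)

  W₂ : Cell → Config n → (Fin N → Fin N → ℕ) → ℕ
  W₂ μ c w = ∑[ i < N ] W μ (c i) (w i)

  W₂-by-columns : ∀ μ c w → W₂ μ c w ≡ ∑[ j < N ] W μ (flip c j) (flip w j)
  W₂-by-columns μ c w = ∑-comm (λ i j → mask (c i j ≟ᶜ μ) (w i j))

  W₂-cong : ∀ {μ c d} w → (∀ i j → c i j ≡ μ ⇔ d i j ≡ μ) → W₂ μ c w ≡ W₂ μ d w
  W₂-cong {μ} {c} {d} w c⇔d =
    sum-cong-≗ λ i → sum-cong-≗ λ j → mask-⇔ {x = w i j} (c i j ≟ᶜ μ) (d i j ≟ᶜ μ) (c⇔d i j)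

  Φ : Config n → (wb wr : Fin N → Fin N → ℕ) → ℕ
  Φ c wb wr = W₂ blue c wb + W₂ red c wr

  module _ {c d} (step : BlueStep c d) {wb wb′ wr : Fin N → Fin N → ℕ}
           (carried : ∀ i j → wb′ i (j ⊕ 1) ≡ wb i j)
           (stuck-≤ : ∀ i j → c i j ≡ blue → BlueBlocked c i j → wb′ i j ≤ wb i j) where

    private
      reds-kept : W₂ red d wr ≡ W₂ red c wr
      reds-kept = W₂-cong wr λ i j → proj₁ (step i j)

      row-≤ : ∀ i → W blue (d i) (wb′ i) ≤ W blue (c i) (wb i)
      row-≤ i = Row.W-step-≤ (step i) (carried i) (stuck-≤ i)

    Φ-blue-step-≤ : Φ d wb′ wr ≤ Φ c wb wr
    Φ-blue-step-≤ = +-mono-≤ (sum-mono-≤ row-≤) (≤-reflexive reds-kept)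

    Φ-blue-step-< : ∀ {i j} → c i j ≡ blue → BlueBlocked c i j → wb′ i j < wb i j →
                    Φ d wb′ wr < Φ c wb wr
    Φ-blue-step-< {i} cij≡blue stuck drop =
      +-mono-<-≤ (sum-mono-< row-≤ i (Row.W-step-< (step i) (carried i) (stuck-≤ i) cij≡blue stuck drop))
                 (≤-reflexive reds-kept)

  module _ {d e} (step : RedStep d e) {wb wr wr′ : Fin N → Fin N → ℕ}
           (carried : ∀ i j → wr′ (i ⊕ 1) j ≡ wr i j)
           (stuck-≤ : ∀ i j → d i j ≡ red → RedBlocked d i j → wr′ i j ≤ wr i j) where

    private
      blues-kept : W₂ blue e wb ≡ W₂ blue d wb
      blues-kept = W₂-cong wb λ i j → proj₁ (step i j)

      column-step : ∀ j → Column.Step (flip d j) (flip e j)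
      column-step j i = step i j

      column-≤ : ∀ j → W red (flip e j) (flip wr′ j) ≤ W red (flip d j) (flip wr j)
      column-≤ j = Column.W-step-≤ (column-step j) (λ i → carried i j) (λ i → stuck-≤ i j)

    Φ-red-step-≤ : Φ e wb wr′ ≤ Φ d wb wr
    Φ-red-step-≤ = +-mono-≤ (≤-reflexive blues-kept) (begin
      W₂ red e wr′                                     ≡⟨ W₂-by-columns red e wr′ ⟩
      ∑[ j < N ] W red (flip e j) (flip wr′ j)         ≤⟨ sum-mono-≤ column-≤ ⟩
      ∑[ j < N ] W red (flip d j) (flip wr j)          ≡⟨ W₂-by-columns red d wr ⟨
      W₂ red d wr                                      ∎)
      where open ≤-Reasoning

    Φ-red-step-< : ∀ {i j} → d i j ≡ red → RedBlocked d i j → wr′ i j < wr i j →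
                   Φ e wb wr′ < Φ d wb wr
    Φ-red-step-< {j = j} dij≡red stuck drop = +-mono-≤-< (≤-reflexive blues-kept) (begin-strict
      W₂ red e wr′                                     ≡⟨ W₂-by-columns red e wr′ ⟩
      ∑[ j < N ] W red (flip e j) (flip wr′ j)         <⟨ sum-mono-< column-≤ j column-< ⟩
      ∑[ j < N ] W red (flip d j) (flip wr j)          ≡⟨ W₂-by-columns red d wr ⟨
      W₂ red d wr                                      ∎)
      where
      open ≤-Reasoning
      column-< : W red (flip e j) (flip wr′ j) < W red (flip d j) (flip wr j)
      column-< = Column.W-step-< (column-step j) (λ i → carried i j) (λ i → stuck-≤ i j) dij≡red stuck drop

  Good₂ : Config n → (lb lr : Fin N → Fin N → Fin N) → Set
  Good₂ c lb lr = ∀ i j → (c i j ≡ blue → ¬ High (lb i j)) × (c i j ≡ red → ¬ High (lr i j))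

  good₂? : ∀ c lb lr → Dec (Good₂ c lb lr)
  good₂? c lb lr = all? λ i → all? λ j →
    ((c i j ≟ᶜ blue) →-dec ¬? (high? (lb i j))) ×-dec ((c i j ≟ᶜ red) →-dec ¬? (high? (lr i j)))

  Good₂-blue-step : ∀ {c d lb lb′ lr} → BlueStep c d → (∀ i → Row.Labelling (lb i) (lb′ i) (lr i)) →
                    Good₂ d lb′ lr → Good₂ c lb lr
  Good₂-blue-step step labelling good i = Row.Good-backward (step i) (labelling i) (good i)

  Good₂-red-step : ∀ {d e lb lr lr′} → RedStep d e →
                   (∀ j → Column.Labelling (flip lr j) (flip lr′ j) (flip lb j)) →
                   Good₂ e lb lr′ → Good₂ d lb lr
  Good₂-red-step step labelling good i j =
    swap (Column.Good-backward (λ i → step i j) (labelling j) (λ i → swap (good i j)) i)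

  cars : Config n → ℕ
  cars c = ∑[ i < N ] ∑[ j < N ] isCar (c i j)

  carCount≡cars : ∀ c → carCount c ≡ cars c
  carCount≡cars c = trans (sum-allFin (λ i → List.sum (map (isCar ∘ c i) (allFin N))))
                          (sum-cong-≗ λ i → sum-allFin (isCar ∘ c i))

  cars≡Φ : ∀ c → cars c ≡ Φ c (λ _ _ → 1) (λ _ _ → 1)
  cars≡Φ c = begin
    ∑[ i < N ] ∑[ j < N ] isCar (c i j)
      ≡⟨ sum-cong-≗ (λ i → sum-cong-≗ λ j → isCar-mask (c i j)) ⟩
    ∑[ i < N ] ∑[ j < N ] (blue-at i j + red-at i j)
      ≡⟨ sum-cong-≗ (λ i → ∑-distrib-+ (blue-at i) (red-at i)) ⟩
    ∑[ i < N ] (∑[ j < N ] blue-at i j + ∑[ j < N ] red-at i j)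
      ≡⟨ ∑-distrib-+ (sum ∘ blue-at) (sum ∘ red-at) ⟩
    Φ c (λ _ _ → 1) (λ _ _ → 1) ∎
    where
    open ≡-Reasoning
    blue-at red-at : Fin N → Fin N → ℕ
    blue-at i j = mask (c i j ≟ᶜ blue) 1
    red-at i j = mask (c i j ≟ᶜ red) 1

  -- Cars are in fact conserved; monotonicity is all that is needed.
  cars-step : ∀ {c d e} → BlueStep c d → RedStep d e → cars e ≤ cars c
  cars-step {c} {d} {e} blue-step red-step = begin
    cars e       ≡⟨ cars≡Φ e ⟩
    Φ e one one  ≤⟨ Φ-red-step-≤ red-step {one} {one} {one} (λ _ _ → refl) (λ _ _ _ _ → ≤-refl) ⟩
    Φ d one one  ≤⟨ Φ-blue-step-≤ blue-step {one} {one} {one} (λ _ _ → refl) (λ _ _ _ _ → ≤-refl) ⟩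
    Φ c one one  ≡⟨ cars≡Φ c ⟨
    cars c       ∎
    where
    open ≤-Reasoning
    one : Fin N → Fin N → ℕ
    one _ _ = 1

  highCars : Config n → (Fin N → Fin N → Fin N) → ℕ
  highCars c l = ∑[ i < N ] ∑[ j < N ] mask (high? (l i j)) (isCar (c i j))

  highCars≡0⇒Good₂ : ∀ {c l} → highCars c l ≡ 0 → Good₂ c l l
  highCars≡0⇒Good₂ {c} {l} none i j = no-high ∘ cong isCar , no-high ∘ cong isCar
    where
    high-at : Fin N → Fin N → ℕ
    high-at i j = mask (high? (l i j)) (isCar (c i j))
    no-high : isCar (c i j) ≡ 1 → ¬ High (l i j)
    no-high car high = contradiction (begin
      1                       ≡⟨ car ⟨
      isCar (c i j)           ≡⟨ mask-yes (high? (l i j)) high ⟨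
      high-at i j             ≤⟨ ≤-sum (high-at i) j ⟩
      ∑[ j < N ] high-at i j  ≤⟨ ≤-sum (sum ∘ high-at) i ⟩
      highCars c l            ≡⟨ none ⟩
      0                       ∎) λ ()
      where open ≤-Reasoning

  exists-low-labelling : ∀ c (l : Fin N → Fin N → Fin N → Fin N) →
                         (∀ i j x → ∑[ a < N ] mask (high? (l a i j)) x ≤ x + x) →
                         cars c + cars c < N → ∃ λ a → Good₂ c (l a) (l a)
  exists-low-labelling c l rarely-high few-cars = proj₁ zero-shift , highCars≡0⇒Good₂ (proj₂ zero-shift)
    where
    F : Fin N → Fin N → Fin N → ℕ
    F a i j = mask (high? (l a i j)) (isCar (c i j))
    isCar-row : Fin N → Fin N → ℕ
    isCar-row i j = isCar (c i j)
    double-count : ∑[ a < N ] highCars c (l a) ≤ cars c + cars c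
    double-count = begin
      ∑[ a < N ] ∑[ i < N ] ∑[ j < N ] F a i j
        ≡⟨ ∑-comm (λ a i → ∑[ j < N ] F a i j) ⟩
      ∑[ i < N ] ∑[ a < N ] ∑[ j < N ] F a i j
        ≡⟨ sum-cong-≗ (λ i → ∑-comm (λ a j → F a i j)) ⟩
      ∑[ i < N ] ∑[ j < N ] ∑[ a < N ] F a i j
        ≤⟨ sum-mono-≤ (λ i → sum-mono-≤ λ j → rarely-high i j (isCar (c i j))) ⟩
      ∑[ i < N ] ∑[ j < N ] (isCar (c i j) + isCar (c i j))
        ≡⟨ sum-cong-≗ (λ i → ∑-distrib-+ (isCar ∘ c i) (isCar ∘ c i)) ⟩
      ∑[ i < N ] (∑[ j < N ] isCar (c i j) + ∑[ j < N ] isCar (c i j))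
        ≡⟨ ∑-distrib-+ (sum ∘ isCar-row) (sum ∘ isCar-row) ⟩
      cars c + cars c ∎
      where open ≤-Reasoning
    zero-shift : ∃ λ a → highCars c (l a) ≡ 0
    zero-shift = sum<k⇒∃≡0 (λ a → highCars c (l a)) (≤-<-trans double-count few-cars)

  module Dynamics (τ : Trajectory n) where
    open Trajectory τ using () renaming (conf to C; mid to D; blueS to blue-step; redS to red-step)

    mid-unique : ∀ {s s′} → C s ≋ C s′ → D s ≋ D s′
    mid-unique = BlueStep-unique (blue-step _) (blue-step _)

    conf-unique : ∀ {s s′} → C s ≋ C s′ → C (suc s) ≋ C (suc s′)
    conf-unique = RedStep-unique (red-step _) (red-step _) ∘ mid-unique

    NoCarBlockedAt-resp : ∀ {s s′} → C s ≋ C s′ → NoCarBlockedAt τ s′ → NoCarBlockedAt τ s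
    NoCarBlockedAt-resp {s} {s′} C≋ free i j =
      (λ blue stuck → proj₁ (free i j) (trans (sym (C≋ i j)) blue) (Row.Blocked-resp {j = j} (C≋ i) stuck)) ,
      (λ red stuck → proj₂ (free i j) (trans (sym (D≋ i j)) red)
                                       (Column.Blocked-resp {j = i} (λ i → D≋ i j) stuck))
      where
      D≋ : D s ≋ D s′
      D≋ = mid-unique C≋

    free-step : ∀ {t} → NoCarBlockedAt τ t → ∀ i j →
                (C t i j ≡ blue ⇔ C (suc t) i (j ⊕ 1) ≡ blue) ×
                (C t i j ≡ red  ⇔ C (suc t) (i ⊕ 1) j ≡ red)
    free-step {t} free i j =
      ⇔.trans (Row.free-flow (blue-step t i) (λ j → proj₁ (free i j)) j)
              (⇔.sym (proj₁ (red-step t i (j ⊕ 1)))) ,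
      ⇔.trans (⇔.sym (proj₁ (blue-step t i j)))
              (Column.free-flow (λ i → red-step t i j) (λ i → proj₂ (free i j)) i)

    free-flight : ∀ t k → (∀ r → r < k → NoCarBlockedAt τ (r + t)) → ∀ i j →
                  (C t i j ≡ blue ⇔ C (k + t) i (j ⊕ k) ≡ blue) ×
                  (C t i j ≡ red  ⇔ C (k + t) (i ⊕ k) j ≡ red)
    free-flight t zero _ i j =
      subst (λ p → C t i j ≡ blue ⇔ C t i p ≡ blue) (sym (⊕-identityʳ j)) ⇔.refl ,
      subst (λ p → C t i j ≡ red ⇔ C t p j ≡ red) (sym (⊕-identityʳ i)) ⇔.refl
    free-flight t (suc k) free i j =
      ⇔.trans (proj₁ flight) (subst (λ p → C (k + t) i (j ⊕ k) ≡ blue ⇔ C (suc k + t) i p ≡ blue)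
                                    (⊕-suc j) (proj₁ (free-step now i (j ⊕ k)))) ,
      ⇔.trans (proj₂ flight) (subst (λ p → C (k + t) (i ⊕ k) j ≡ red ⇔ C (suc k + t) p j ≡ red)
                                    (⊕-suc i) (proj₂ (free-step now (i ⊕ k) j)))
      where
      flight : (C t i j ≡ blue ⇔ C (k + t) i (j ⊕ k) ≡ blue) × (C t i j ≡ red ⇔ C (k + t) (i ⊕ k) j ≡ red)
      flight = free-flight t k (λ r r<k → free r (m<n⇒m<1+n r<k)) i j
      now : NoCarBlockedAt τ (k + t)
      now = free k ≤-refl
      ⊕-suc : ∀ p → (p ⊕ k) ⊕ 1 ≡ p ⊕ suc k
      ⊕-suc p = trans (⊕-assoc p k 1) (cong (p ⊕_) (+-comm k 1))

    free-period : ∀ {t} → (∀ r → r < N → NoCarBlockedAt τ (r + t)) → C (N + t) ≋ C t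
    free-period {t} free i j = sym (cell-≡
      (subst (λ p → C t i j ≡ blue ⇔ C (N + t) i p ≡ blue) (⊕-N j) (proj₁ flight))
      (subst (λ p → C t i j ≡ red ⇔ C (N + t) p j ≡ red) (⊕-N i) (proj₂ flight)))
      where
      flight : (C t i j ≡ blue ⇔ C (N + t) i (j ⊕ N) ≡ blue) × (C t i j ≡ red ⇔ C (N + t) (i ⊕ N) j ≡ red)
      flight = free-flight t N free i j

    -- a + i + j − t, since n ≡ −1 (mod N).
    label : ℕ → Fin N → Fin N → Fin N → Fin N
    label t a i j = ((a ⊕ toℕ i) ⊕ toℕ j) ⊕ (n * t)

    weight : ℕ → Fin N → Fin N → Fin N → ℕ
    weight t a i j = toℕ (label t a i j)

    module _ (t : ℕ) (a i j : Fin N) where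

      label-offset : label t a i j ≡ a ⊕ (toℕ i + toℕ j + n * t)
      label-offset = trans (cong (_⊕ (n * t)) (⊕-assoc a (toℕ i) (toℕ j)))
                           (⊕-assoc a (toℕ i + toℕ j) (n * t))

      label-right : label t a i (j ⊕ 1) ≡ label t a i j ⊕ 1
      label-right = trans (cong (_⊕ (n * t)) (⊕-toℕ (a ⊕ toℕ i) j 1))
                          (⊕-swap ((a ⊕ toℕ i) ⊕ toℕ j) 1 (n * t))

      label-up : label t a (i ⊕ 1) j ≡ label t a i j ⊕ 1
      label-up = begin
        ((a ⊕ toℕ (i ⊕ 1)) ⊕ toℕ j) ⊕ (n * t)
          ≡⟨ cong (λ x → (x ⊕ toℕ j) ⊕ (n * t)) (⊕-toℕ a i 1) ⟩
        (((a ⊕ toℕ i) ⊕ 1) ⊕ toℕ j) ⊕ (n * t)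
          ≡⟨ cong (_⊕ (n * t)) (⊕-swap (a ⊕ toℕ i) 1 (toℕ j)) ⟩
        (((a ⊕ toℕ i) ⊕ toℕ j) ⊕ 1) ⊕ (n * t)
          ≡⟨ ⊕-swap ((a ⊕ toℕ i) ⊕ toℕ j) 1 (n * t) ⟩
        label t a i j ⊕ 1 ∎
        where open ≡-Reasoning

      label-tick : label (suc t) a i j ⊕ 1 ≡ label t a i j
      label-tick = trans (⊕-assoc origin (n * suc t) 1)
                         (trans (cong (origin ⊕_) one-period-later) (⊕-period origin (n * t)))
        where
        origin : Fin N
        origin = (a ⊕ toℕ i) ⊕ toℕ j
        one-period-later : n * suc t + 1 ≡ N + n * t
        one-period-later = trans (cong (_+ 1) (*-suc n t)) (+-comm (n + n * t) 1)

    label-carried-right : ∀ t a i j → label (suc t) a i (j ⊕ 1) ≡ label t a i j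
    label-carried-right t a i j = trans (label-right (suc t) a i j) (label-tick t a i j)

    label-carried-up : ∀ t a i j → label (suc t) a (i ⊕ 1) j ≡ label t a i j
    label-carried-up t a i j = trans (label-up (suc t) a i j) (label-tick t a i j)

    blue-labelling : ∀ t a i → Row.Labelling (label t a i) (label (suc t) a i) (label t a i)
    blue-labelling t a i = record
      { ascending = label-right t a i
      ; carried   = label-carried-right t a i
      ; ticked    = label-tick t a i
      ; blocker   = λ j top → inj₁ (subst Top (sym (label-right t a i j)) top)
      }

    red-labelling : ∀ t a j →
                    Column.Labelling (flip (label t a) j) (flip (label (suc t) a) j) (flip (label (suc t) a) j)
    red-labelling t a j = record
      { ascending = λ i → label-up t a i j
      ; carried   = λ i → label-carried-up t a i j
      ; ticked    = λ i → label-tick t a i j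
      ; blocker   = λ i top → subst High (sym (label-carried-up t a i j)) (inj₂ top)
      }

    Good : ℕ → Fin N → Set
    Good t a = Good₂ (C t) (label t a) (label t a)

    -- In the intermediate configuration the blue cars have moved already and carry the labels
    -- of time t + 1, the red ones still those of time t.
    Good-mid : ℕ → Fin N → Set
    Good-mid t a = Good₂ (D t) (label (suc t) a) (label t a)

    good? : ∀ t a → Dec (Good t a)
    good? t a = good₂? (C t) (label t a) (label t a)

    Φ-at : ℕ → Fin N → ℕ
    Φ-at t a = Φ (C t) (weight t a) (weight t a)

    Φ-mid : ℕ → Fin N → ℕ
    Φ-mid t a = Φ (D t) (weight (suc t) a) (weight t a)

    module _ (t : ℕ) (a : Fin N) where

      Good-mid⇒Good : Good-mid t a → Good t a
      Good-mid⇒Good = Good₂-blue-step (blue-step t) (blue-labelling t a)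

      Good-suc⇒Good-mid : Good (suc t) a → Good-mid t a
      Good-suc⇒Good-mid = Good₂-red-step (red-step t) (red-labelling t a)

      Good-antitone : Good (suc t) a → Good t a
      Good-antitone = Good-mid⇒Good ∘ Good-suc⇒Good-mid

      private
        blue-carried : ∀ i j → weight (suc t) a i (j ⊕ 1) ≡ weight t a i j
        blue-carried i j = cong toℕ (label-carried-right t a i j)

        red-carried : ∀ i j → weight (suc t) a (i ⊕ 1) j ≡ weight t a i j
        red-carried i j = cong toℕ (label-carried-up t a i j)

      blue-stuck-drops : Good-mid t a → ∀ i j → C t i j ≡ blue → BlueBlocked (C t) i j →
                         weight (suc t) a i j < weight t a i j
      blue-stuck-drops good i j = Row.stuck-label-drops (blue-step t i) (blue-labelling t a i) (good i)

      red-stuck-drops : Good (suc t) a → ∀ i j → D t i j ≡ red → RedBlocked (D t) i j →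
                        weight (suc t) a i j < weight t a i j
      red-stuck-drops good i j =
        Column.stuck-label-drops (λ i → red-step t i j) (red-labelling t a j) (λ i → swap (good i j)) {i}

      private
        blue-stuck-≤ : Good-mid t a → ∀ i j → C t i j ≡ blue → BlueBlocked (C t) i j →
                       weight (suc t) a i j ≤ weight t a i j
        blue-stuck-≤ good i j b stuck = <⇒≤ (blue-stuck-drops good i j b stuck)

        red-stuck-≤ : Good (suc t) a → ∀ i j → D t i j ≡ red → RedBlocked (D t) i j →
                      weight (suc t) a i j ≤ weight t a i j
        red-stuck-≤ good i j r stuck = <⇒≤ (red-stuck-drops good i j r stuck)

      Φ-mid≤Φ : Good-mid t a → Φ-mid t a ≤ Φ-at t a
      Φ-mid≤Φ good =
        Φ-blue-step-≤ (blue-step t) {weight t a} {weight (suc t) a} {weight t a} blue-carried (blue-stuck-≤ good)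

      Φ-mid<Φ : Good-mid t a → ∀ {i j} → C t i j ≡ blue → BlueBlocked (C t) i j → Φ-mid t a < Φ-at t a
      Φ-mid<Φ good {i} {j} b stuck =
        Φ-blue-step-< (blue-step t) {weight t a} {weight (suc t) a} {weight t a} blue-carried (blue-stuck-≤ good)
                      b stuck (blue-stuck-drops good i j b stuck)

      Φ-suc≤Φ-mid : Good (suc t) a → Φ-at (suc t) a ≤ Φ-mid t a
      Φ-suc≤Φ-mid good =
        Φ-red-step-≤ (red-step t) {weight (suc t) a} {weight t a} {weight (suc t) a} red-carried (red-stuck-≤ good)

      Φ-suc<Φ-mid : Good (suc t) a → ∀ {i j} → D t i j ≡ red → RedBlocked (D t) i j →
                    Φ-at (suc t) a < Φ-mid t a
      Φ-suc<Φ-mid good {i} {j} r stuck =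
        Φ-red-step-< (red-step t) {weight (suc t) a} {weight t a} {weight (suc t) a} red-carried (red-stuck-≤ good)
                     r stuck (red-stuck-drops good i j r stuck)

      Φ-antitone : Good (suc t) a → Φ-at (suc t) a ≤ Φ-at t a
      Φ-antitone good = ≤-trans (Φ-suc≤Φ-mid good) (Φ-mid≤Φ (Good-suc⇒Good-mid good))

    M : ℕ → ℕ
    M t = ∑[ a < N ] mask (good? t a) (Φ-at t a)

    M-antitone-at : ∀ t a → mask (good? (suc t) a) (Φ-at (suc t) a) ≤ mask (good? t a) (Φ-at t a)
    M-antitone-at t a = mask-mono (good? (suc t) a) (good? t a) (Good-antitone t a) (Φ-antitone t a)

    M-antitone : ∀ t → M (suc t) ≤ M t
    M-antitone t = sum-mono-≤ (M-antitone-at t)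

    M-drops : ∀ t a → Good (suc t) a → Φ-at (suc t) a < Φ-at t a → M (suc t) < M t
    M-drops t a good Φ-drops =
      sum-mono-< (M-antitone-at t) a (mask-mono-< (good? (suc t) a) (good? t a) good (Good-antitone t a) Φ-drops)

    M-stable⇒free : ∀ {t} → ∃ (Good (suc t)) → M (suc t) ≡ M t → NoCarBlockedAt τ t
    M-stable⇒free {t} (a , good) stable i j =
      (λ b stuck → <-irrefl stable (M-drops t a good (blue-drop b stuck))) ,
      (λ r stuck → <-irrefl stable (M-drops t a good (red-drop r stuck)))
      where
      good-mid : Good-mid t a
      good-mid = Good-suc⇒Good-mid t a good
      blue-drop : C t i j ≡ blue → BlueBlocked (C t) i j → Φ-at (suc t) a < Φ-at t a
      blue-drop b stuck = ≤-<-trans (Φ-suc≤Φ-mid t a good) (Φ-mid<Φ t a good-mid b stuck)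
      red-drop : D t i j ≡ red → RedBlocked (D t) i j → Φ-at (suc t) a < Φ-at t a
      red-drop r stuck = <-≤-trans (Φ-suc<Φ-mid t a good r stuck) (Φ-mid≤Φ t a good-mid)

    cars≤initial : ∀ t → cars (C t) ≤ cars (C 0)
    cars≤initial zero    = ≤-refl
    cars≤initial (suc t) = ≤-trans (cars-step (blue-step t) (red-step t)) (cars≤initial t)

    exists-good : ∀ t → cars (C t) + cars (C t) < N → ∃ (Good t)
    exists-good t = exists-low-labelling (C t) (λ a → label t a) rarely-high
      where
      rarely-high : ∀ i j x → ∑[ a < N ] mask (high? (label t a i j)) x ≤ x + x
      rarely-high i j x =
        subst (_≤ x + x) (sum-cong-≗ λ a → cong (λ y → mask (high? y) x) (sym (label-offset t a i j)))
              (sum-high-⊕ (toℕ i + toℕ j + n * t) x)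

    orbit-from-period : ∀ {T} → C (N + T) ≋ C T → ∀ d → ∃ λ r → r < N × C (d + T) ≋ C (r + T)
    orbit-from-period         period zero = 0 , z<s , λ _ _ → refl
    orbit-from-period {T} period (suc d) with orbit-from-period period d
    ... | r , r<N , C≋ with suc r <? N
    ...   | yes 1+r<N = suc r , 1+r<N , conf-unique C≋
    ...   | no  1+r≮N = 0 , z<s , λ i j → trans (conf-unique C≋ i j) (wrap i j)
      where
      wrap : C (suc r + T) ≋ C T
      wrap = subst (λ k → C (k + T) ≋ C T) (≤-antisym (≮⇒≥ 1+r≮N) r<N) period

    -- Constructively M need not reveal when it becomes constant, hence the detour through a
    -- plateau of length N and the periodicity it forces.
    speed-one-from : (∀ t → ∃ (Good t)) → ∀ T → M (N + T) ≡ M T → SpeedOne τ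
    speed-one-from good-shift T plateau-at-T = T , eventually-free
      where
      window : ∀ r → r < N → NoCarBlockedAt τ (r + T)
      window r r<N =
        M-stable⇒free (good-shift (suc (r + T))) (plateau-steps {M} M-antitone {N} {T} plateau-at-T r r<N)

      period : C (N + T) ≋ C T
      period = free-period window

      eventually-free : ∀ t → T ≤ t → NoCarBlockedAt τ t
      eventually-free t T≤t =
        let r , r<N , C≋ = orbit-from-period period (t ∸ T)
        in subst (NoCarBlockedAt τ) (m∸n+n≡m T≤t) (NoCarBlockedAt-resp C≋ (window r r<N))

    speed-one : (∀ t → ∃ (Good t)) → SpeedOne τ
    speed-one good-shift = uncurry (speed-one-from good-shift) (plateau {M} M-antitone N)

proposition1 : (n m : ℕ) → 2 * m < suc n → (τ : Trajectory n) →
    carCount (conf τ 0) ≡ m → SpeedOne τ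
proposition1 n m 2m<N τ count = speed-one λ t → exists-good t (≤-<-trans (+-mono-≤ (few t) (few t)) m+m<N)
  where
  open Torus n
  open Dynamics τ
  m+m<N : m + m < N
  m+m<N = subst (_< N) (cong (m +_) (+-identityʳ m)) 2m<N
  few : ∀ t → cars (conf τ t) ≤ m
  few t = ≤-trans (cars≤initial t) (≤-reflexive (trans (sym (carCount≡cars (conf τ 0))) count))
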